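{- Let $(s,h)\in\mathcal{S}$, $\rho$ a resource configuration, $\Gamma$ a resource context, $Q$ an assertion and $A\subseteq\mathbf{Var}$ with $FV(Q)\subseteq A$. If $s,h\models Q$, then $\mathit{Safe}_n(\mathsf{skip},s,h,\rho,\Gamma,Q,A)$ holds for every $n\ge0$.
   Context: States and assertions: stores $s:\mathbf{Var}\to\mathbf{Val}$, finite partial heaps $h$, $\mathcal{S}$ the set of pairs $(s,h)$; assertions are separation-logic assertions with the standard satisfaction $s,h\models P$ and free variables $FV(P)$; $h\bot g$ disjoint domains, $h\uplus g$ union. A resource context $\Gamma=r_1(X_1):R_1,\dots,r_n(X_n):R_n$ (distinct resource names $r_i$, $X_i\subseteq\mathbf{Var}$, precise assertions $R_i$ with $FV(R_i)\subseteq X_i$); $PV(r_i)=X_i$, $\Gamma(r_i)=R_i$, $\circledast_{r\in D}\Gamma(r)$ the separating conjunction over $D$ ($\texttt{emp}$ if empty). A resource configuration is a triple $(O,L,D)$ of pairwise disjoint sets of resource names. Commands include $\mathsf{skip}$, basic commands, $;$, $\mathsf{if}$, $\mathsf{while}$, $\mathsf{resource}\ r\ \mathsf{in}\ C$, $\mathsf{with}\ r\ \mathsf{when}\ B\ \mathsf{do}\ C$, $\|$ and $\mathsf{within}\ r\ \mathsf{do}\ C$, with $Locked(C)$ the set of resources held inside $C$ ($Locked(C_1;C_2)=Locked(C_1)$, $Locked(C_1\|C_2)=Locked(C_1)\cup Locked(C_2)$, $Locked(\mathsf{resource}\ r\ \mathsf{in}\ C)=Locked(C)\setminus\{r\}$,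 $Locked(\mathsf{within}\ r\ \mathsf{do}\ C)=Locked(C)\cup\{r\}$, else $\emptyset$). $\to_p$ is the program transition relation of the structural operational semantics; in particular $\mathsf{skip}$ has no program transition and no transition to $\mathsf{abort}$. Environment: $(s,h,(O,L,D))\stackrel{A}{\leftrightsquigarrow}(s',h,(O,L',D'))$ iff $s(x)=s'(x)$ for $x\in A$ and $L'\cup D'=L\cup D$. With $A'=A\cup\bigcup_{r\in Locked(C)}PV(r)$: if $(s,h,\rho)\stackrel{A'}{\leftrightsquigarrow}(s',h,\rho')$, $\rho=(O,L,D)$, $\rho'=(O,L',D')$, $s,h_G\models\circledast_{r\in D}\Gamma(r)$ and $s',h'_G\models\circledast_{r\in D'}\Gamma(r)$, then $C,(s,h\uplus h_G,\rho)\xrightarrow{A,\Gamma}_eC,(s',h\uplus h'_G,\rho')$. $\xrightarrow{A,\Gamma}=\to_p\cup\xrightarrow{A,\Gamma}_e$. $chng(C)$: the variables $x$ such that the next transition of $C$ can execute $x:=e$, $x:=[e]$ or $x:=\mathsf{cons}(\dots)$. Safety: $\mathit{Safe}_0(C,s,h,\rho,\Gamma,Q,A)$ always holds; $\mathit{Safe}_{n+1}(C,s,h,\rho,\Gamma,Q,A)$, $\rho=(O,L,D)$, holds iff (i) if $C=\mathsf{skip}$ then $s,h\models Q$; (ii) $C,(s,h,\rho)\not\to_p\mathsf{abort}$; (iii) $chng(C)\cap\bigcup_{r\in L\cup D}PV(r)=\emptyset$; (iv) for every $h_G\bot h$ with $s,h_G\models\circledast_{r\in D}\Gamma(r)$ and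 every $C,(s,h\uplus h_G,\rho)\xrightarrow{A,\Gamma}C',(s',\hat h,\rho')$, $\rho'=(O',L',D')$, there exist $h',h'_G$ with $\hat h=h'\uplus h'_G$, $s',h'_G\models\circledast_{r\in D'}\Gamma(r)$ and $\mathit{Safe}_n(C',s',h',\rho',\Gamma,Q,A)$. -}

module Defs where

open import Level using (Level; 0ℓ) renaming (suc to lsuc)
open import Data.Nat using (ℕ; zero; suc; _<_)
open import Data.Integer using (ℤ; +_) renaming (_+_ to _+ℤ_; _-_ to _-ℤ_; _*_ to _*ℤ_)
import Data.Integer as ℤ
import Data.Nat as ℕ
open import Data.Bool using (Bool; true; false; if_then_else_; _∧_; _∨_; not)
open import Data.Maybe using (Maybe; just; nothing)
open import Data.List using (List; []; _∷_; map; length)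
open import Data.List.Membership.Propositional using (_∈_)
open import Data.List.Relation.Unary.All using (All)
open import Data.List.Relation.Unary.Any using (Any)
open import Data.List.Relation.Unary.Unique.Propositional using (Unique)
open import Data.Product using (Σ; ∃; _×_; _,_; proj₁; proj₂)
open import Data.Sum using (_⊎_)
open import Data.Empty using (⊥)
import Data.Unit.Polymorphic as UP
open import Relation.Nullary using (¬_)
open import Relation.Nullary.Decidable using (⌊_⌋)
open import Relation.Binary.PropositionalEquality using (_≡_; _≢_)

Var : Set
Var = ℕ

Val : Set
Val = ℤ

RName : Set
RName = ℕ

VSet : Set₁
VSet = Var → Set

RSet : Set₁
RSet = RName → Set

Store : Set
Store = Var → Val

_[_↦_] : Store → Var → Val → Store
(s [ x ↦ v ]) y = if ⌊ y ℕ.≟ x ⌋ then v else s y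

record Heap : Set where
  field
    fun    : Val → Maybe Val
    finite : Σ (List Val) λ xs → ∀ l v → fun l ≡ just v → l ∈ xs
open Heap public

Disjoint : Heap → Heap → Set
Disjoint h g = ∀ l → fun h l ≡ nothing ⊎ fun g l ≡ nothing

merge : Maybe Val → Maybe Val → Maybe Val
merge (just v) _ = just v
merge nothing m = m

Union : Heap → Heap → Heap → Set
Union h g k = Disjoint h g × (∀ l → fun k l ≡ merge (fun h l) (fun g l))

_⊑_ : Heap → Heap → Set
h₁ ⊑ h₂ = ∀ l v → fun h₁ l ≡ just v → fun h₂ l ≡ just v

_≈ₕ_ : Heap → Heap → Set
h₁ ≈ₕ h₂ = ∀ l → fun h₁ l ≡ fun h₂ l

data Exp : Set where
  num   : Val → Exp
  var   : Var → Exp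
  _⊕_   : Exp → Exp → Exp
  _⊖_   : Exp → Exp → Exp
  _⊛ₑ_  : Exp → Exp → Exp

⟦_⟧ : Exp → Store → Val
⟦ num v ⟧ s = v
⟦ var x ⟧ s = s x
⟦ e ⊕ f ⟧ s = ⟦ e ⟧ s +ℤ ⟦ f ⟧ s
⟦ e ⊖ f ⟧ s = ⟦ e ⟧ s -ℤ ⟦ f ⟧ s
⟦ e ⊛ₑ f ⟧ s = ⟦ e ⟧ s *ℤ ⟦ f ⟧ s

data BExp : Set where
  btrue bfalse : BExp
  _≐_ _≤ᵇ_     : Exp → Exp → BExp
  bnot         : BExp → BExp
  _band_ _bor_ : BExp → BExp → BExp

⟦_⟧ᵇ : BExp → Store → Bool
⟦ btrue ⟧ᵇ s = true
⟦ bfalse ⟧ᵇ s = false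
⟦ e ≐ f ⟧ᵇ s = ⌊ ⟦ e ⟧ s ℤ.≟ ⟦ f ⟧ s ⌋
⟦ e ≤ᵇ f ⟧ᵇ s = ⌊ ⟦ e ⟧ s ℤ.≤? ⟦ f ⟧ s ⌋
⟦ bnot b ⟧ᵇ s = not (⟦ b ⟧ᵇ s)
⟦ b band c ⟧ᵇ s = ⟦ b ⟧ᵇ s ∧ ⟦ c ⟧ᵇ s
⟦ b bor c ⟧ᵇ s = ⟦ b ⟧ᵇ s ∨ ⟦ c ⟧ᵇ s

FVₑ : Exp → VSet
FVₑ (num v) x = ⊥
FVₑ (var y) x = x ≡ y
FVₑ (e ⊕ f) x = FVₑ e x ⊎ FVₑ f x
FVₑ (e ⊖ f) x = FVₑ e x ⊎ FVₑ f x
FVₑ (e ⊛ₑ f) x = FVₑ e x ⊎ FVₑ f x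

FVᵇ : BExp → VSet
FVᵇ btrue x = ⊥
FVᵇ bfalse x = ⊥
FVᵇ (e ≐ f) x = FVₑ e x ⊎ FVₑ f x
FVᵇ (e ≤ᵇ f) x = FVₑ e x ⊎ FVₑ f x
FVᵇ (bnot b) x = FVᵇ b x
FVᵇ (b band c) x = FVᵇ b x ⊎ FVᵇ c x
FVᵇ (b bor c) x = FVᵇ b x ⊎ FVᵇ c x

data Assn : Set where
  emp    : Assn
  pure   : BExp → Assn
  _↦_    : Exp → Exp → Assn
  _∗_    : Assn → Assn → Assn
  _-∗_   : Assn → Assn → Assn
  _∧ₐ_   : Assn → Assn → Assn
  _∨ₐ_   : Assn → Assn → Assn
  _⇒ₐ_   : Assn → Assn → Assn
  ¬ₐ_    : Assn → Assn
  ∀ₐ     : Var → Assn → Assn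
  ∃ₐ     : Var → Assn → Assn

_,_⊨_ : Store → Heap → Assn → Set
s , h ⊨ emp = ∀ l → fun h l ≡ nothing
s , h ⊨ pure b = ⟦ b ⟧ᵇ s ≡ true
s , h ⊨ (e ↦ f) = fun h (⟦ e ⟧ s) ≡ just (⟦ f ⟧ s) × (∀ l → l ≢ ⟦ e ⟧ s → fun h l ≡ nothing)
s , h ⊨ (P ∗ Q) = Σ Heap λ h₁ → Σ Heap λ h₂ → Union h₁ h₂ h × s , h₁ ⊨ P × s , h₂ ⊨ Q
s , h ⊨ (P -∗ Q) = ∀ h' k → Union h h' k → s , h' ⊨ P → s , k ⊨ Q
s , h ⊨ (P ∧ₐ Q) = s , h ⊨ P × s , h ⊨ Q
s , h ⊨ (P ∨ₐ Q) = s , h ⊨ P ⊎ s , h ⊨ Q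
s , h ⊨ (P ⇒ₐ Q) = s , h ⊨ P → s , h ⊨ Q
s , h ⊨ (¬ₐ P) = ¬ (s , h ⊨ P)
s , h ⊨ ∀ₐ x P = ∀ v → (s [ x ↦ v ]) , h ⊨ P
s , h ⊨ ∃ₐ x P = Σ Val λ v → (s [ x ↦ v ]) , h ⊨ P

FV : Assn → VSet
FV emp x = ⊥
FV (pure b) x = FVᵇ b x
FV (e ↦ f) x = FVₑ e x ⊎ FVₑ f x
FV (P ∗ Q) x = FV P x ⊎ FV Q x
FV (P -∗ Q) x = FV P x ⊎ FV Q x
FV (P ∧ₐ Q) x = FV P x ⊎ FV Q x
FV (P ∨ₐ Q) x = FV P x ⊎ FV Q x
FV (P ⇒ₐ Q) x = FV P x ⊎ FV Q x
FV (¬ₐ P) x = FV P x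
FV (∀ₐ y P) x = FV P x × x ≢ y
FV (∃ₐ y P) x = FV P x × x ≢ y

Precise : Assn → Set
Precise R = ∀ s h h₁ h₂ → h₁ ⊑ h → h₂ ⊑ h → s , h₁ ⊨ R → s , h₂ ⊨ R → h₁ ≈ₕ h₂

record Entry : Set₁ where
  constructor _⟨_⟩∶_
  field
    name : RName
    vars : VSet
    inv  : Assn
open Entry public

record ResCtx : Set₁ where
  field
    entries  : List Entry
    distinct : Unique (map name entries)
    precise  : All (λ e → Precise (inv e)) entries
    fv-ok    : All (λ e → ∀ x → FV (inv e) x → vars e x) entries
open ResCtx public

PVₗ : List Entry → RName → VSet
PVₗ [] r x = ⊥
PVₗ (e ∷ es) r x = (name e ≡ r × vars e x) ⊎ PVₗ es r x

PV : ResCtx → RName → VSet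
PV Γ r x = PVₗ (entries Γ) r x

-- s , h ⊨ ⊛_{r ∈ D} Γ(r)   (resources of D not declared in Γ contribute emp)
sat⊛ : List Entry → RSet → Store → Heap → Set
sat⊛ [] D s h = ∀ l → fun h l ≡ nothing
sat⊛ (e ∷ es) D s h =
  (D (name e) × Σ Heap λ h₁ → Σ Heap λ h₂ → Union h₁ h₂ h × s , h₁ ⊨ inv e × sat⊛ es D s h₂)
  ⊎ (¬ D (name e) × sat⊛ es D s h)

_,_⊨⊛_within_ : Store → Heap → RSet → ResCtx → Set
s , h ⊨⊛ D within Γ = sat⊛ (entries Γ) D s h

record RConf : Set₁ where
  constructor ⟨_,_,_⟩
  field
    O L D : RSet
open RConf public

IsRConf : RConf → Set
IsRConf ρ = (∀ r → O ρ r → L ρ r → ⊥) × (∀ r → O ρ r → D ρ r → ⊥) × (∀ r → L ρ r → D ρ r → ⊥)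

_∪ₛ_ : RSet → RSet → RSet
(X ∪ₛ Y) r = X r ⊎ Y r

_+ₛ_ : RSet → RName → RSet
(X +ₛ r) x = X x ⊎ x ≡ r

_-ₛ_ : RSet → RName → RSet
(X -ₛ r) x = X x × x ≢ r

data Cmd : Set where
  skip      : Cmd
  _≔_       : Var → Exp → Cmd
  _≔[_]     : Var → Exp → Cmd
  [_]≔_     : Exp → Exp → Cmd
  _≔cons_   : Var → List Exp → Cmd
  dispose   : Exp → Cmd
  _⨾_       : Cmd → Cmd → Cmd
  ifc_then_else_ : BExp → Cmd → Cmd → Cmd
  while_▷_ : BExp → Cmd → Cmd
  resource_∶_ : RName → Cmd → Cmd
  withr_when_▷_ : RName → BExp → Cmd → Cmd
  _∥_       : Cmd → Cmd → Cmd
  within_▷_ : RName → Cmd → Cmd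

Locked : Cmd → RSet
Locked (C₁ ⨾ C₂) = Locked C₁
Locked (C₁ ∥ C₂) = Locked C₁ ∪ₛ Locked C₂
Locked (resource r ∶ C) = Locked C -ₛ r
Locked (within r ▷ C) = Locked C +ₛ r
Locked _ = λ _ → ⊥

-- chng(C): variables the next transition of C can assign
chng : Cmd → VSet
chng (x ≔ e) y = y ≡ x
chng (x ≔[ e ]) y = y ≡ x
chng (x ≔cons es) y = y ≡ x
chng (C₁ ⨾ C₂) y = chng C₁ y
chng (C₁ ∥ C₂) y = chng C₁ y ⊎ chng C₂ y
chng (resource r ∶ C) y = chng C y
chng (within r ▷ C) y = chng C y
chng _ y = ⊥

data Res : Set₁ where
  ok    : Cmd → Store → Heap → RConf → Res
  abort : Res

InRange : Val → ℕ → Val → Set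
InRange l k m = Σ ℕ λ i → i < k × m ≡ l +ℤ (+ i)

allocAt : Val → List Val → Val → Maybe Val → Maybe Val
allocAt l [] m old = old
allocAt l (v ∷ vs) m old = if ⌊ m ℤ.≟ l ⌋ then just v else allocAt (l +ℤ (+ 1)) vs m old

data _⟶p_ : Cmd × Store × Heap × RConf → Res → Set₁ where
  assign : ∀ {x e s h ρ} → (x ≔ e , s , h , ρ) ⟶p ok skip (s [ x ↦ ⟦ e ⟧ s ]) h ρ
  load : ∀ {x e s h ρ v} → fun h (⟦ e ⟧ s) ≡ just v →
    (x ≔[ e ] , s , h , ρ) ⟶p ok skip (s [ x ↦ v ]) h ρ
  load-abort : ∀ {x e s h ρ} → fun h (⟦ e ⟧ s) ≡ nothing →
    (x ≔[ e ] , s , h , ρ) ⟶p abort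
  mutate : ∀ {e f s h h' ρ} → fun h (⟦ e ⟧ s) ≢ nothing →
    fun h' (⟦ e ⟧ s) ≡ just (⟦ f ⟧ s) → (∀ l → l ≢ ⟦ e ⟧ s → fun h' l ≡ fun h l) →
    ([ e ]≔ f , s , h , ρ) ⟶p ok skip s h' ρ
  mutate-abort : ∀ {e f s h ρ} → fun h (⟦ e ⟧ s) ≡ nothing →
    ([ e ]≔ f , s , h , ρ) ⟶p abort
  alloc : ∀ {x es s h h' ρ} (l : Val) →
    (∀ m → InRange l (length es) m → fun h m ≡ nothing) →
    (∀ m → fun h' m ≡ allocAt l (map (λ e → ⟦ e ⟧ s) es) m (fun h m)) →
    (x ≔cons es , s , h , ρ) ⟶p ok skip (s [ x ↦ l ]) h' ρ
  free : ∀ {e s h h' ρ} → fun h (⟦ e ⟧ s) ≢ nothing →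
    fun h' (⟦ e ⟧ s) ≡ nothing → (∀ l → l ≢ ⟦ e ⟧ s → fun h' l ≡ fun h l) →
    (dispose e , s , h , ρ) ⟶p ok skip s h' ρ
  free-abort : ∀ {e s h ρ} → fun h (⟦ e ⟧ s) ≡ nothing →
    (dispose e , s , h , ρ) ⟶p abort
  seq-skip : ∀ {C s h ρ} → (skip ⨾ C , s , h , ρ) ⟶p ok C s h ρ
  seq : ∀ {C₁ C₁' C₂ s h ρ s' h' ρ'} → (C₁ , s , h , ρ) ⟶p ok C₁' s' h' ρ' →
    (C₁ ⨾ C₂ , s , h , ρ) ⟶p ok (C₁' ⨾ C₂) s' h' ρ'
  seq-abort : ∀ {C₁ C₂ s h ρ} → (C₁ , s , h , ρ) ⟶p abort → (C₁ ⨾ C₂ , s , h , ρ) ⟶p abort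
  if-true : ∀ {B C₁ C₂ s h ρ} → ⟦ B ⟧ᵇ s ≡ true →
    (ifc B then C₁ else C₂ , s , h , ρ) ⟶p ok C₁ s h ρ
  if-false : ∀ {B C₁ C₂ s h ρ} → ⟦ B ⟧ᵇ s ≡ false →
    (ifc B then C₁ else C₂ , s , h , ρ) ⟶p ok C₂ s h ρ
  loop : ∀ {B C s h ρ} →
    (while B ▷ C , s , h , ρ) ⟶p ok (ifc B then (C ⨾ (while B ▷ C)) else skip) s h ρ
  par-l : ∀ {C₁ C₁' C₂ s h ρ s' h' ρ'} → (C₁ , s , h , ρ) ⟶p ok C₁' s' h' ρ' →
    (C₁ ∥ C₂ , s , h , ρ) ⟶p ok (C₁' ∥ C₂) s' h' ρ'
  par-r : ∀ {C₁ C₂ C₂' s h ρ s' h' ρ'} → (C₂ , s , h , ρ) ⟶p ok C₂' s' h' ρ' →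
    (C₁ ∥ C₂ , s , h , ρ) ⟶p ok (C₁ ∥ C₂') s' h' ρ'
  par-abort-l : ∀ {C₁ C₂ s h ρ} → (C₁ , s , h , ρ) ⟶p abort → (C₁ ∥ C₂ , s , h , ρ) ⟶p abort
  par-abort-r : ∀ {C₁ C₂ s h ρ} → (C₂ , s , h , ρ) ⟶p abort → (C₁ ∥ C₂ , s , h , ρ) ⟶p abort
  par-skip : ∀ {s h ρ} → (skip ∥ skip , s , h , ρ) ⟶p ok skip s h ρ
  res-skip : ∀ {r s h ρ} → (resource r ∶ skip , s , h , ρ) ⟶p ok skip s h ρ
  -- local resource r, currently held by C: r is owned inside
  res-held : ∀ {r C C' s h O L D s' h' O' L' D'} →
    ¬ (O r ⊎ L r ⊎ D r) → Locked C r →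
    (C , s , h , ⟨ O +ₛ r , L , D ⟩) ⟶p ok C' s' h' ⟨ O' , L' , D' ⟩ →
    (resource r ∶ C , s , h , ⟨ O , L , D ⟩) ⟶p ok (resource r ∶ C') s' h' ⟨ O' -ₛ r , L' -ₛ r , D' -ₛ r ⟩
  -- local resource r, not held by C: r is available inside
  res-free : ∀ {r C C' s h O L D s' h' O' L' D'} →
    ¬ (O r ⊎ L r ⊎ D r) → ¬ Locked C r →
    (C , s , h , ⟨ O , L , D +ₛ r ⟩) ⟶p ok C' s' h' ⟨ O' , L' , D' ⟩ →
    (resource r ∶ C , s , h , ⟨ O , L , D ⟩) ⟶p ok (resource r ∶ C') s' h' ⟨ O' -ₛ r , L' -ₛ r , D' -ₛ r ⟩
  res-held-abort : ∀ {r C s h O L D} →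
    ¬ (O r ⊎ L r ⊎ D r) → Locked C r →
    (C , s , h , ⟨ O +ₛ r , L , D ⟩) ⟶p abort →
    (resource r ∶ C , s , h , ⟨ O , L , D ⟩) ⟶p abort
  res-free-abort : ∀ {r C s h O L D} →
    ¬ (O r ⊎ L r ⊎ D r) → ¬ Locked C r →
    (C , s , h , ⟨ O , L , D +ₛ r ⟩) ⟶p abort →
    (resource r ∶ C , s , h , ⟨ O , L , D ⟩) ⟶p abort
  acquire : ∀ {r B C s h O L D} → D r → ⟦ B ⟧ᵇ s ≡ true →
    (withr r when B ▷ C , s , h , ⟨ O , L , D ⟩) ⟶p ok (within r ▷ C) s h ⟨ O +ₛ r , L , D -ₛ r ⟩
  release : ∀ {r s h O L D} →
    (within r ▷ skip , s , h , ⟨ O , L , D ⟩) ⟶p ok skip s h ⟨ O -ₛ r , L , D +ₛ r ⟩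
  within-step : ∀ {r C C' s h ρ s' h' ρ'} → (C , s , h , ρ) ⟶p ok C' s' h' ρ' →
    (within r ▷ C , s , h , ρ) ⟶p ok (within r ▷ C') s' h' ρ'
  within-abort : ∀ {r C s h ρ} → (C , s , h , ρ) ⟶p abort →
    (within r ▷ C , s , h , ρ) ⟶p abort

extA : VSet → ResCtx → Cmd → VSet
extA A Γ C x = A x ⊎ (Σ RName λ r → Locked C r × PV Γ r x)

data EnvStep (A : VSet) (Γ : ResCtx) : Cmd × Store × Heap × RConf → Res → Set₁ where
  env : ∀ {C s s' k k' O L D L' D'} (h hG hG' : Heap) →
    (∀ x → extA A Γ C x → s x ≡ s' x) →
    (∀ r → (L' r ⊎ D' r) → (L r ⊎ D r)) → (∀ r → (L r ⊎ D r) → (L' r ⊎ D' r)) →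
    IsRConf ⟨ O , L' , D' ⟩ →
    s , hG ⊨⊛ D within Γ → s' , hG' ⊨⊛ D' within Γ →
    Union h hG k → Union h hG' k' →
    EnvStep A Γ (C , s , k , ⟨ O , L , D ⟩) (ok C s' k' ⟨ O , L' , D' ⟩)

data Step (A : VSet) (Γ : ResCtx) (c : Cmd × Store × Heap × RConf) (r : Res) : Set₁ where
  prog : c ⟶p r → Step A Γ c r
  envr : EnvStep A Γ c r → Step A Γ c r

Safe : ℕ → Cmd → Store → Heap → RConf → ResCtx → Assn → VSet → Set₁
Safe zero C s h ρ Γ Q A = UP.⊤
Safe (suc n) C s h ρ Γ Q A =
  (C ≡ skip → s , h ⊨ Q)
  × (¬ ((C , s , h , ρ) ⟶p abort))
  × (∀ x → chng C x → Σ RName (λ r → (L ρ r ⊎ D ρ r) × PV Γ r x) → ⊥)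
  × (∀ (hG : Heap) → Disjoint h hG → s , hG ⊨⊛ D ρ within Γ →
     ∀ (k : Heap) → Union h hG k →
     ∀ C' s' ĥ ρ' → Step A Γ (C , s , k , ρ) (ok C' s' ĥ ρ') →
     Σ Heap λ h' → Σ Heap λ hG' → Union h' hG' ĥ × s' , hG' ⊨⊛ D ρ' within Γ
       × Safe n C' s' h' ρ' Γ Q A)

-- The command skip takes no program step and cannot abort, so the only moves to
-- check are environment steps. Such a step re-splits the global heap into the
-- thread's part and a part satisfying the invariants of the available resources;
-- since the invariants are precise, that frame is the old one, so the thread's
-- heap is unchanged. The store may change, but only outside A ⊇ FV(Q), so Q
-- still holds and the argument repeats for every remaining step.
module Submission where

open import Defs
open import Data.Nat using (ℕ; zero; suc)
import Data.Nat as ℕ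
import Data.Integer as ℤ
open import Data.Bool using (not; _∧_; _∨_)
open import Data.Maybe using (Maybe; just; nothing)
open import Data.List using ([]; _∷_)
open import Data.List.Relation.Unary.All using (All; []; _∷_)
open import Data.Product using (Σ; _×_; _,_)
open import Data.Sum using (_⊎_; inj₁; inj₂; map₂)
open import Data.Empty using (⊥-elim)
import Data.Unit.Polymorphic as UP
open import Function using (_∘_)
open import Relation.Nullary using (¬_; yes; no)
open import Relation.Binary.PropositionalEquality
  using (_≡_; _≢_; refl; sym; trans; cong; cong₂; subst)

AgreeOn : VSet → Store → Store → Set
AgreeOn F s s' = ∀ x → F x → s x ≡ s' x

module _ {F : VSet} {s s' : Store} where

  AgreeOn-sym : AgreeOn F s s' → AgreeOn F s' s
  AgreeOn-sym ag x = sym ∘ ag x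

  AgreeOn-update : ∀ {x} v → AgreeOn (λ y → F y × y ≢ x) s s' →
                   AgreeOn F (s [ x ↦ v ]) (s' [ x ↦ v ])
  AgreeOn-update {x} v ag y y∈F with y ℕ.≟ x
  ... | yes _   = refl
  ... | no  y≢x = ag y (y∈F , y≢x)

module _ {F G : VSet} {s s' : Store} where

  AgreeOn-⊎ˡ : AgreeOn (λ x → F x ⊎ G x) s s' → AgreeOn F s s'
  AgreeOn-⊎ˡ ag x = ag x ∘ inj₁

  AgreeOn-⊎ʳ : AgreeOn (λ x → F x ⊎ G x) s s' → AgreeOn G s s'
  AgreeOn-⊎ʳ ag x = ag x ∘ inj₂

⟦⟧-coincidence : ∀ e {s s'} → AgreeOn (FVₑ e) s s' → ⟦ e ⟧ s ≡ ⟦ e ⟧ s'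
⟦⟧-coincidence (num v)  ag = refl
⟦⟧-coincidence (var x)  ag = ag x refl
⟦⟧-coincidence (e ⊕ f)  ag = cong₂ ℤ._+_ (⟦⟧-coincidence e (AgreeOn-⊎ˡ ag)) (⟦⟧-coincidence f (AgreeOn-⊎ʳ ag))
⟦⟧-coincidence (e ⊖ f)  ag = cong₂ ℤ._-_ (⟦⟧-coincidence e (AgreeOn-⊎ˡ ag)) (⟦⟧-coincidence f (AgreeOn-⊎ʳ ag))
⟦⟧-coincidence (e ⊛ₑ f) ag = cong₂ ℤ._*_ (⟦⟧-coincidence e (AgreeOn-⊎ˡ ag)) (⟦⟧-coincidence f (AgreeOn-⊎ʳ ag))

⟦⟧ᵇ-coincidence : ∀ b {s s'} → AgreeOn (FVᵇ b) s s' → ⟦ b ⟧ᵇ s ≡ ⟦ b ⟧ᵇ s'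
⟦⟧ᵇ-coincidence btrue      ag = refl
⟦⟧ᵇ-coincidence bfalse     ag = refl
⟦⟧ᵇ-coincidence (e ≐ f)    ag
  rewrite ⟦⟧-coincidence e (AgreeOn-⊎ˡ ag) | ⟦⟧-coincidence f (AgreeOn-⊎ʳ ag) = refl
⟦⟧ᵇ-coincidence (e ≤ᵇ f)   ag
  rewrite ⟦⟧-coincidence e (AgreeOn-⊎ˡ ag) | ⟦⟧-coincidence f (AgreeOn-⊎ʳ ag) = refl
⟦⟧ᵇ-coincidence (bnot b)   ag = cong not (⟦⟧ᵇ-coincidence b ag)
⟦⟧ᵇ-coincidence (b band c) ag = cong₂ _∧_ (⟦⟧ᵇ-coincidence b (AgreeOn-⊎ˡ ag)) (⟦⟧ᵇ-coincidence c (AgreeOn-⊎ʳ ag))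
⟦⟧ᵇ-coincidence (b bor c)  ag = cong₂ _∨_ (⟦⟧ᵇ-coincidence b (AgreeOn-⊎ˡ ag)) (⟦⟧ᵇ-coincidence c (AgreeOn-⊎ʳ ag))

⊨-coincidence : ∀ P {s s'} h → AgreeOn (FV P) s s' → s , h ⊨ P → s' , h ⊨ P
⊨-coincidence emp      h ag p = p
⊨-coincidence (pure b) h ag p = trans (sym (⟦⟧ᵇ-coincidence b ag)) p
⊨-coincidence (e ↦ f)  h ag p
  rewrite ⟦⟧-coincidence e (AgreeOn-⊎ˡ ag) | ⟦⟧-coincidence f (AgreeOn-⊎ʳ ag) = p
⊨-coincidence (P ∗ Q)  h ag (h₁ , h₂ , u , p , q) =
  h₁ , h₂ , u , ⊨-coincidence P h₁ (AgreeOn-⊎ˡ ag) p , ⊨-coincidence Q h₂ (AgreeOn-⊎ʳ ag) q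
⊨-coincidence (P -∗ Q) h ag f h' k u p =
  ⊨-coincidence Q k (AgreeOn-⊎ʳ ag) (f h' k u (⊨-coincidence P h' (AgreeOn-sym (AgreeOn-⊎ˡ ag)) p))
⊨-coincidence (P ∧ₐ Q) h ag (p , q) =
  ⊨-coincidence P h (AgreeOn-⊎ˡ ag) p , ⊨-coincidence Q h (AgreeOn-⊎ʳ ag) q
⊨-coincidence (P ∨ₐ Q) h ag (inj₁ p) = inj₁ (⊨-coincidence P h (AgreeOn-⊎ˡ ag) p)
⊨-coincidence (P ∨ₐ Q) h ag (inj₂ q) = inj₂ (⊨-coincidence Q h (AgreeOn-⊎ʳ ag) q)
⊨-coincidence (P ⇒ₐ Q) h ag f p =
  ⊨-coincidence Q h (AgreeOn-⊎ʳ ag) (f (⊨-coincidence P h (AgreeOn-sym (AgreeOn-⊎ˡ ag)) p))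
⊨-coincidence (¬ₐ P)   h ag f p = f (⊨-coincidence P h (AgreeOn-sym ag) p)
⊨-coincidence (∀ₐ x P) h ag f v = ⊨-coincidence P h (AgreeOn-update v ag) (f v)
⊨-coincidence (∃ₐ x P) h ag (v , p) = v , ⊨-coincidence P h (AgreeOn-update v ag) p

≈ₕ-sym : ∀ {h h'} → h ≈ₕ h' → h' ≈ₕ h
≈ₕ-sym h≈h' l = sym (h≈h' l)

Union-resp-≈ₕ₁ : ∀ {h h' g k} → h ≈ₕ h' → Union h g k → Union h' g k
Union-resp-≈ₕ₁ {h} {h'} {g} {k} h≈h' (d , u) = d' , u'
  where
  d' : Disjoint h' g
  d' l = subst (λ m → m ≡ nothing ⊎ fun g l ≡ nothing) (h≈h' l) (d l)
  u' : ∀ l → fun k l ≡ merge (fun h' l) (fun g l)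
  u' l = trans (u l) (cong (λ m → merge m (fun g l)) (h≈h' l))

Union-resp-≈ₕ₃ : ∀ {h g k k'} → k ≈ₕ k' → Union h g k → Union h g k'
Union-resp-≈ₕ₃ k≈k' (d , u) = d , λ l → trans (sym (k≈k' l)) (u l)

⊨-resp-≈ₕ : ∀ P s {h h'} → h ≈ₕ h' → s , h ⊨ P → s , h' ⊨ P
⊨-resp-≈ₕ emp      s h≈h' p l = trans (sym (h≈h' l)) (p l)
⊨-resp-≈ₕ (pure b) s h≈h' p = p
⊨-resp-≈ₕ (e ↦ f)  s h≈h' (p , q) = trans (sym (h≈h' _)) p , λ l l≢e → trans (sym (h≈h' l)) (q l l≢e)
⊨-resp-≈ₕ (P ∗ Q)  s {h} {h'} h≈h' (h₁ , h₂ , u , p , q) =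
  h₁ , h₂ , Union-resp-≈ₕ₃ {h₁} {h₂} {h} {h'} h≈h' u , p , q
⊨-resp-≈ₕ (P -∗ Q) s {h} {h'} h≈h' f h'' k u =
  f h'' k (Union-resp-≈ₕ₁ {h'} {h} {h''} {k} (≈ₕ-sym {h} {h'} h≈h') u)
⊨-resp-≈ₕ (P ∧ₐ Q) s h≈h' (p , q) = ⊨-resp-≈ₕ P s h≈h' p , ⊨-resp-≈ₕ Q s h≈h' q
⊨-resp-≈ₕ (P ∨ₐ Q) s h≈h' (inj₁ p) = inj₁ (⊨-resp-≈ₕ P s h≈h' p)
⊨-resp-≈ₕ (P ∨ₐ Q) s h≈h' (inj₂ q) = inj₂ (⊨-resp-≈ₕ Q s h≈h' q)
⊨-resp-≈ₕ (P ⇒ₐ Q) s {h} {h'} h≈h' f = ⊨-resp-≈ₕ Q s h≈h' ∘ f ∘ ⊨-resp-≈ₕ P s (≈ₕ-sym {h} {h'} h≈h')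
⊨-resp-≈ₕ (¬ₐ P)   s {h} {h'} h≈h' f = f ∘ ⊨-resp-≈ₕ P s (≈ₕ-sym {h} {h'} h≈h')
⊨-resp-≈ₕ (∀ₐ x P) s h≈h' f v = ⊨-resp-≈ₕ P _ h≈h' (f v)
⊨-resp-≈ₕ (∃ₐ x P) s h≈h' (v , p) = v , ⊨-resp-≈ₕ P _ h≈h' p

⊑-trans : ∀ {h₁ h₂ h₃} → h₁ ⊑ h₂ → h₂ ⊑ h₃ → h₁ ⊑ h₃
⊑-trans h₁⊑h₂ h₂⊑h₃ l v = h₂⊑h₃ l v ∘ h₁⊑h₂ l v

Union⇒⊑₁ : ∀ {h g k} → Union h g k → h ⊑ k
Union⇒⊑₁ {g = g} (_ , u) l v hl≡v = trans (u l) (cong (λ m → merge m (fun g l)) hl≡v)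

Union⇒⊑₂ : ∀ {h g k} → Union h g k → g ⊑ k
Union⇒⊑₂ {g = g} (d , u) l v gl≡v with d l
... | inj₁ hl≡∅ = trans (u l) (trans (cong (λ m → merge m (fun g l)) hl≡∅) gl≡v)
... | inj₂ gl≡∅ with () ← trans (sym gl≡∅) gl≡v

Union-functional : ∀ {h h' g g' k k'} → h ≈ₕ h' → g ≈ₕ g' →
                   Union h g k → Union h' g' k' → k ≈ₕ k'
Union-functional h≈h' g≈g' (_ , u) (_ , u') l =
  trans (u l) (trans (cong₂ merge (h≈h' l) (g≈g' l)) (sym (u' l)))

merge-cancelʳ : ∀ {a a' b : Maybe Val} → a ≡ nothing ⊎ b ≡ nothing → a' ≡ nothing ⊎ b ≡ nothing →
                merge a b ≡ merge a' b → a ≡ a'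
merge-cancelʳ {nothing} {nothing} _ _ _ = refl
merge-cancelʳ {just _} {just _} {nothing} _ _ eq = eq
merge-cancelʳ {just _} {nothing} {nothing} _ _ ()
merge-cancelʳ {nothing} {just _} {nothing} _ _ ()
merge-cancelʳ {just _} {_} {just _} (inj₁ ()) _ _
merge-cancelʳ {just _} {_} {just _} (inj₂ ()) _ _
merge-cancelʳ {nothing} {just _} {just _} _ (inj₁ ()) _
merge-cancelʳ {nothing} {just _} {just _} _ (inj₂ ()) _

Union-cancelʳ : ∀ {h h' g g' k} → g ≈ₕ g' → Union h g k → Union h' g' k → h ≈ₕ h'
Union-cancelʳ {h' = h'} g≈g' (d , u) (d' , u') l =
  merge-cancelʳ (d l) (map₂ (trans (g≈g' l)) (d' l))
    (trans (sym (u l)) (trans (u' l) (cong (merge (fun h' l)) (sym (g≈g' l)))))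

sat⊛-precise : ∀ es → All (λ e → Precise (inv e)) es → ∀ D s {g₁ g₂} k →
               g₁ ⊑ k → g₂ ⊑ k → sat⊛ es D s g₁ → sat⊛ es D s g₂ → g₁ ≈ₕ g₂
sat⊛-precise [] _ D s _ _ _ g₁≡∅ g₂≡∅ l = trans (g₁≡∅ l) (sym (g₂≡∅ l))
sat⊛-precise (e ∷ es) (precise-e ∷ precise-es) D s {g₁} {g₂} k g₁⊑k g₂⊑k
  (inj₁ (_ , a₁ , a₂ , ua , a₁⊨e , a₂⊨es)) (inj₁ (_ , b₁ , b₂ , ub , b₁⊨e , b₂⊨es)) =
  Union-functional {a₁} {b₁} {a₂} {b₂} {g₁} {g₂} a₁≈b₁ a₂≈b₂ ua ub
  where
  a₁≈b₁ : a₁ ≈ₕ b₁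
  a₁≈b₁ = precise-e s k a₁ b₁
            (⊑-trans {a₁} {g₁} {k} (Union⇒⊑₁ {a₁} {a₂} {g₁} ua) g₁⊑k)
            (⊑-trans {b₁} {g₂} {k} (Union⇒⊑₁ {b₁} {b₂} {g₂} ub) g₂⊑k) a₁⊨e b₁⊨e
  a₂≈b₂ : a₂ ≈ₕ b₂
  a₂≈b₂ = sat⊛-precise es precise-es D s k
            (⊑-trans {a₂} {g₁} {k} (Union⇒⊑₂ {a₁} {a₂} {g₁} ua) g₁⊑k)
            (⊑-trans {b₂} {g₂} {k} (Union⇒⊑₂ {b₁} {b₂} {g₂} ub) g₂⊑k) a₂⊨es b₂⊨es
sat⊛-precise (e ∷ es) _ D s k _ _ (inj₁ (e∈D , _)) (inj₂ (e∉D , _)) = ⊥-elim (e∉D e∈D)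
sat⊛-precise (e ∷ es) _ D s k _ _ (inj₂ (e∉D , _)) (inj₁ (e∈D , _)) = ⊥-elim (e∉D e∈D)
sat⊛-precise (e ∷ es) (_ ∷ precise-es) D s k g₁⊑k g₂⊑k (inj₂ (_ , g₁⊨es)) (inj₂ (_ , g₂⊨es)) =
  sat⊛-precise es precise-es D s k g₁⊑k g₂⊑k g₁⊨es g₂⊨es

⊨⊛-cancelʳ : ∀ Γ D s {h h' g g' k} → Union h g k → Union h' g' k →
              s , g ⊨⊛ D within Γ → s , g' ⊨⊛ D within Γ → h ≈ₕ h'
⊨⊛-cancelʳ Γ D s {h} {h'} {g} {g'} {k} u u' g⊨D g'⊨D =
  Union-cancelʳ {h} {h'} {g} {g'} {k} g≈g' u u'
  where
  g≈g' : g ≈ₕ g'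
  g≈g' = sat⊛-precise (entries Γ) (precise Γ) D s k
           (Union⇒⊑₂ {h} {g} {k} u) (Union⇒⊑₂ {h'} {g'} {k} u') g⊨D g'⊨D

skip-irreducible : ∀ {s h ρ r} → ¬ ((skip , s , h , ρ) ⟶p r)
skip-irreducible ()

proposition10 : (s : Store) (h : Heap) (ρ : RConf) (Γ : ResCtx) (Q : Assn) (A : VSet) →
    IsRConf ρ → (∀ x → FV Q x → A x) → s , h ⊨ Q →
    (n : ℕ) → Safe n skip s h ρ Γ Q A
proposition10 s h ρ Γ Q A _ FV⊆A h⊨Q zero = UP.tt
proposition10 s h ρ Γ Q A _ FV⊆A h⊨Q (suc n) =
  (λ _ → h⊨Q) , skip-irreducible , (λ _ ()) , step
  where
  step : ∀ (hG : Heap) → Disjoint h hG → s , hG ⊨⊛ D ρ within Γ →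
         ∀ (k : Heap) → Union h hG k →
         ∀ C' s' ĥ ρ' → Step A Γ (skip , s , k , ρ) (ok C' s' ĥ ρ') →
         Σ Heap λ h' → Σ Heap λ hG' → Union h' hG' ĥ × s' , hG' ⊨⊛ D ρ' within Γ
           × Safe n C' s' h' ρ' Γ Q A
  step _ _ _ _ _ _ _ _ _ (prog p) = ⊥-elim (skip-irreducible p)
  step hG _ hG⊨D k u _ s' _ _ (envr (env h₀ hG₀ hG₁ s≈s' _ _ ρ'-ok hG₀⊨D hG₁⊨D' u₀ u₁)) =
    h₀ , hG₁ , u₁ , hG₁⊨D' ,
    proposition10 s' h₀ _ Γ Q A ρ'-ok FV⊆A
      (⊨-coincidence Q h₀ (λ x x∈FV → s≈s' x (inj₁ (FV⊆A x x∈FV)))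
        (⊨-resp-≈ₕ Q s (⊨⊛-cancelʳ Γ (D ρ) s {h} {h₀} {hG} {hG₀} {k} u u₀ hG⊨D hG₀⊨D) h⊨Q))
      n
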